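{- Let $m\geq 2$ and $n\geq 5$ with $n$ odd, and fix a Dyck word $u\in D_{n-3}$. Let $L_{m\times n}$ be the set of all binary $m\times n$ matrices $A$ with rows $A_1,\dots,A_m$ (each read as a binary string of length $n$) such that: (i) $A_1=11u0$ (the same first row for every matrix of the set), and $A_i\neq 11u0$ for every $i=2,\dots,m$; (ii) for each $i=2,\dots,m-1$, the row $A_i$ is of one of the following forms: (type 6) $A_i=1w$ with $w\in D_{n-1}$, $w\neq 1u0$; (type 7) $A_i=w0$ with $w\in D_{n-1}$, $w\neq 1u0$; (type 8) $A_i=0w$ with $w\in D_{n-1}$; (iii) the last row $A_m$ is of type 6 or type 7. Then $L_{m\times n}$ is a non-overlapping set of matrices.
   Context: For $\ell\geq 1$, a Dyck word of length $2\ell$ is a binary string $v$ of length $2\ell$ with equally many $1$'s and $0$'s such that every prefix of $v$ contains at least as many $1$'s as $0$'s; $D_{2\ell}$ denotes the set of Dyck words of length $2\ell$. Concatenation of strings is written by juxtaposition. Two binary $m\times n$ matrices $A=(a_{i,j})$ and $B=(b_{i,j})$ overlap at shift $(p,q)\in\mathbb{Z}^2$ with $|p|\leq m-1$, $|q|\leq n-1$ if $a_{i,j}=b_{i+p,j+q}$ for all $(i,j)$ with $1\leq i,i+p\leq m$ and $1\leq j,j+q\leq n$ (i.e., after rigidly translating one matrix over the other, without rotation, all entries in the common rectangular region coincide). Two distinct matrices $A,B$ are non-overlapping if they overlap at no such shift; a matrix $A$ is self non-overlapping if $A$ and $A$ overlap at no such shift with $(p,q)\neq(0,0)$. A set of $m\times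 n$ matrices is non-overlapping if each of its matrices is self non-overlapping and any two distinct matrices in it are non-overlapping. -}

module Defs where

open import Data.Bool using (Bool; true; false)
open import Data.Nat using (ℕ; zero; suc; _+_; _*_; _∸_; _≤_; _<_)
open import Data.List using (List; []; _∷_; _++_; [_]; length; take)
open import Data.Vec using (Vec; lookup; toList)
open import Data.Fin using (Fin; toℕ)
open import Data.Integer as ℤ using (ℤ; +_)
open import Data.Product using (Σ; _×_; ∃)
open import Data.Sum using (_⊎_)
open import Relation.Nullary using (¬_)
open import Relation.Binary.PropositionalEquality using (_≡_; _≢_)

-- binary strings: List Bool, true = 1, false = 0
ones : List Bool → ℕ
ones [] = 0
ones (true ∷ v) = suc (ones v)
ones (false ∷ v) = ones v

zeros : List Bool → ℕ
zeros [] = 0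
zeros (true ∷ v) = zeros v
zeros (false ∷ v) = suc (zeros v)

-- v ∈ D_{2ℓ}  (ℓ ≥ 1)
Dyck : ℕ → List Bool → Set
Dyck ℓ v = 1 ≤ ℓ × length v ≡ 2 * ℓ × ones v ≡ zeros v
         × (∀ k → zeros (take k v) ≤ ones (take k v))

Matrix : ℕ → ℕ → Set
Matrix m n = Vec (Vec Bool n) m

entry : ∀ {m n} → Matrix m n → Fin m → Fin n → Bool
entry A i j = lookup (lookup A i) j

row : ∀ {m n} → Matrix m n → Fin m → List Bool
row A i = toList (lookup A i)

OverlapAt : ∀ {m n} → Matrix m n → Matrix m n → ℤ → ℤ → Set
OverlapAt {m} {n} A B p q =
  ∀ (i i' : Fin m) (j j' : Fin n) →
    + toℕ i' ≡ (+ toℕ i) ℤ.+ p → + toℕ j' ≡ (+ toℕ j) ℤ.+ q →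
    entry A i j ≡ entry B i' j'

AdmShift : ℕ → ℕ → ℤ → ℤ → Set
AdmShift m n p q = ℤ.∣ p ∣ < m × ℤ.∣ q ∣ < n

NonOverlapping : ∀ {m n} → Matrix m n → Matrix m n → Set
NonOverlapping {m} {n} A B = ∀ p q → AdmShift m n p q → ¬ OverlapAt A B p q

SelfNonOverlapping : ∀ {m n} → Matrix m n → Set
SelfNonOverlapping {m} {n} A =
  ∀ p q → AdmShift m n p q → ¬ (p ≡ + 0 × q ≡ + 0) → ¬ OverlapAt A A p q

NonOverlappingSet : ∀ {m n} → (Matrix m n → Set) → Set
NonOverlappingSet {m} {n} S =
  (∀ A → S A → SelfNonOverlapping A)
  × (∀ A B → S A → S B → A ≢ B → NonOverlapping A B)

Odd : ℕ → Set
Odd n = ∃ λ k → n ≡ 2 * k + 1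

Type6 : ℕ → List Bool → List Bool → Set
Type6 n u r = Σ (List Bool) λ w → Dyck ((n ∸ 1) Data.Nat./ 2) w × w ≢ true ∷ u ++ [ false ] × r ≡ true ∷ w

Type7 : ℕ → List Bool → List Bool → Set
Type7 n u r = Σ (List Bool) λ w → Dyck ((n ∸ 1) Data.Nat./ 2) w × w ≢ true ∷ u ++ [ false ] × r ≡ w ++ [ false ]

Type8 : ℕ → List Bool → List Bool → Set
Type8 n u r = Σ (List Bool) λ w → Dyck ((n ∸ 1) Data.Nat./ 2) w × r ≡ false ∷ w

L : (m n : ℕ) → List Bool → Matrix m n → Set
L m n u A =
  (∀ i → toℕ i ≡ 0 → row A i ≡ true ∷ true ∷ u ++ [ false ])
  × (∀ i → 1 ≤ toℕ i → row A i ≢ true ∷ true ∷ u ++ [ false ])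
  × (∀ i → 1 ≤ toℕ i → suc (toℕ i) < m →
        Type6 n u (row A i) ⊎ Type7 n u (row A i) ⊎ Type8 n u (row A i))
  × (∀ i → suc (toℕ i) ≡ m → Type6 n u (row A i) ⊎ Type7 n u (row A i))

module Submission where

open import Defs
open import Data.Nat using (ℕ; _≤_; _∸_; _/_)
open import Data.Bool using (Bool)
open import Data.List using (List)

open import Data.Bool using (true; false)
open import Data.Nat using (zero; suc; _+_; _<_; z≤n; s≤s; s≤s⁻¹; _<?_)
open import Data.Nat.Properties
  using (+-suc; +-comm; +-identityʳ; suc-injective; ≤-refl; ≤-reflexive; ≤-trans; ≤-antisym;
         <⇒≱; ≮⇒≥; n≤1+n; m≤m+n; m≤n+m; m∸n≤m; m∸n+n≡m; m+n∸n≡m;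
         +-cancelˡ-≤; +-mono-≤; +-mono-≤-<)
open import Data.List using ([]; _∷_; _++_; [_]; take; drop; length)
open import Data.List.Properties using (length-++; take++drop≡id; take-all)
open import Data.Vec as Vec using (Vec; lookup; toList)
open import Data.Vec.Properties using (length-toList; tabulate∘lookup; tabulate-cong)
open import Data.Fin as Fin using (Fin; toℕ; fromℕ; fromℕ<)
open import Data.Fin.Properties using (toℕ-fromℕ; toℕ-fromℕ<; toℕ<n)
open import Data.Integer as ℤ using (+_; -[1+_])
import Data.Integer.Properties as ℤP
open import Data.Product using (∃; _×_; _,_; proj₁; proj₂)
open import Data.Sum using (_⊎_; inj₁; inj₂; map₂)
open import Data.Empty using (⊥; ⊥-elim)
open import Relation.Nullary using (¬_; yes; no)
open import Relation.Binary.PropositionalEquality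
  using (_≡_; _≢_; refl; sym; trans; cong; cong₂; subst; module ≡-Reasoning)

-- Read a binary word as a lattice path and compare its numbers of
-- 1s and 0s.  Every nonempty prefix of the first row 11u0 has strictly more 1s
-- than 0s, while every nonempty proper suffix of every admissible row (types
-- 6, 7, 8, and 11u0 itself) has at least as many 0s as 1s.  A nontrivial
-- overlap of A over B (WLOG with vertical shift p ≥ 0, by symmetry) lines up
-- the first row of A with row p of B:
--  * q > 0: a prefix of 11u0 equals a proper suffix of a row -- impossible;
--  * q = 0, p > 0: a later row of B equals 11u0 -- excluded by (i);
--  * q < 0, overlap width 1: the last row of B starts with 1, but it sits
--    under the last letter of a row of A, a suffix with no surplus of 1s;
--  * q < 0, width ≥ 2: a proper suffix of 11u0 is a prefix of a shaped row,
--    which is ruled out using that the proper suffixes of the primitive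
--    Dyck word 1u0 have strictly more 0s than 1s (and w ≠ 1u0 for type 7).

ones-++ : ∀ xs ys → ones (xs ++ ys) ≡ ones xs + ones ys
ones-++ [] ys = refl
ones-++ (true ∷ xs) ys = cong suc (ones-++ xs ys)
ones-++ (false ∷ xs) ys = ones-++ xs ys

zeros-++ : ∀ xs ys → zeros (xs ++ ys) ≡ zeros xs + zeros ys
zeros-++ [] ys = refl
zeros-++ (true ∷ xs) ys = zeros-++ xs ys
zeros-++ (false ∷ xs) ys = cong suc (zeros-++ xs ys)

take-++ˡ : ∀ {A : Set} k (xs : List A) {ys} → k ≤ length xs → take k (xs ++ ys) ≡ take k xs
take-++ˡ zero xs _ = refl
take-++ˡ (suc k) (x ∷ xs) (s≤s k≤xs) = cong (x ∷_) (take-++ˡ k xs k≤xs)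

drop-tail : ∀ {A : Set} s (xs : List A) {y ys} → drop s xs ≡ y ∷ ys → drop (suc s) xs ≡ ys
drop-tail zero [] ()
drop-tail zero (x ∷ xs) refl = refl
drop-tail (suc s) [] ()
drop-tail (suc s) (x ∷ xs) eq = drop-tail s xs eq

length-init : ∀ (w : List Bool) {x} k e → length (w ++ [ x ]) ≡ k + suc e → length w ≡ k + e
length-init w k e h =
  suc-injective (trans (trans (+-comm 1 (length w)) (sym (length-++ w))) (trans h (+-suc k e)))

cancel-≤ : ∀ {a b c d} → a + b ≡ c + d → a ≤ c → d ≤ b
cancel-≤ {a} {b} {c} {d} eq a≤c =
  +-cancelˡ-≤ c d b (≤-trans (≤-reflexive (sym eq)) (+-mono-≤ a≤c ≤-refl))

nonpositive≢positive : ∀ {x y} → x ≡ y → ones x ≤ zeros x → zeros y < ones y → ⊥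
nonpositive≢positive refl x≤ y< = <⇒≱ y< x≤

negative≢nonnegative : ∀ {x y} → x ≡ y → ones x < zeros x → zeros y ≤ ones y → ⊥
negative≢nonnegative refl x< y≤ = <⇒≱ x< y≤

Balanced : List Bool → Set
Balanced w = ones w ≡ zeros w

Dominated : List Bool → Set
Dominated w = ∀ k → zeros (take k w) ≤ ones (take k w)

CoDominated : List Bool → Set
CoDominated w = ∀ s → ones (drop s w) ≤ zeros (drop s w)

dyck-balanced : ∀ {ℓ w} → Dyck ℓ w → Balanced w
dyck-balanced (_ , _ , bal , _) = bal

dyck-dominated : ∀ {ℓ w} → Dyck ℓ w → Dominated w
dyck-dominated (_ , _ , _ , dom) = dom

dyck-head : ∀ {ℓ w} → Dyck ℓ w → ∃ λ w' → w ≡ true ∷ w'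
dyck-head {zero} (() , _)
dyck-head {suc ℓ} {[]} (_ , () , _)
dyck-head {suc ℓ} {true ∷ w} _ = w , refl
dyck-head {suc ℓ} {false ∷ w} (_ , _ , _ , dom) with dom 1
... | ()

split-counts : ∀ w → Balanced w → ∀ s →
  ones (take s w) + ones (drop s w) ≡ zeros (take s w) + zeros (drop s w)
split-counts w bal s = begin
  ones (take s w) + ones (drop s w)    ≡⟨ sym (ones-++ (take s w) (drop s w)) ⟩
  ones (take s w ++ drop s w)          ≡⟨ cong ones (take++drop≡id s w) ⟩
  ones w                               ≡⟨ bal ⟩
  zeros w                              ≡⟨ cong zeros (sym (take++drop≡id s w)) ⟩
  zeros (take s w ++ drop s w)         ≡⟨ zeros-++ (take s w) (drop s w) ⟩
  zeros (take s w) + zeros (drop s w)  ∎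
  where open ≡-Reasoning

dominated⇒codominated : ∀ {w} → Balanced w → Dominated w → CoDominated w
dominated⇒codominated {w} bal dom s = cancel-≤ (sym (split-counts w bal s)) (dom s)

codominated⇒dominated : ∀ {w} → Balanced w → CoDominated w → Dominated w
codominated⇒dominated {w} bal codom k =
  cancel-≤ (trans (+-comm (ones (drop k w)) _) (trans (split-counts w bal k) (+-comm (zeros (take k w)) _)))
           (codom k)

codominated-[false] : CoDominated [ false ]
codominated-[false] zero = z≤n
codominated-[false] (suc zero) = z≤n
codominated-[false] (suc (suc s)) = z≤n

codominated-++ : ∀ xs {ys} → CoDominated xs → CoDominated ys → CoDominated (xs ++ ys)
codominated-++ xs {ys} cx cy zero rewrite ones-++ xs ys | zeros-++ xs ys = +-mono-≤ (cx 0) (cy 0)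
codominated-++ [] cx cy (suc s) = cy (suc s)
codominated-++ (x ∷ xs) cx cy (suc s) = codominated-++ xs (λ s' → cx (suc s')) cy s

strict-suffix-++ : ∀ xs {ys} → CoDominated xs → ones ys < zeros ys →
  ∀ s → s ≤ length xs → ones (drop s (xs ++ ys)) < zeros (drop s (xs ++ ys))
strict-suffix-++ xs {ys} cx ny zero _ rewrite ones-++ xs ys | zeros-++ xs ys = +-mono-≤-< (cx 0) ny
strict-suffix-++ [] cx ny (suc s) ()
strict-suffix-++ (x ∷ xs) cx ny (suc s) (s≤s s≤xs) =
  strict-suffix-++ xs (λ s' → cx (suc s')) ny s s≤xs

lift : List Bool → List Bool
lift u = true ∷ u ++ [ false ]

lift-balanced : ∀ u → Balanced u → Balanced (lift u)
lift-balanced u bal = begin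
  suc (ones (u ++ [ false ]))  ≡⟨ cong suc (ones-++ u [ false ]) ⟩
  suc (ones u + 0)             ≡⟨ cong suc (+-identityʳ (ones u)) ⟩
  suc (ones u)                 ≡⟨ cong suc bal ⟩
  suc (zeros u)                ≡⟨ +-comm 1 (zeros u) ⟩
  zeros u + 1                  ≡⟨ sym (zeros-++ u [ false ]) ⟩
  zeros (u ++ [ false ])       ∎
  where open ≡-Reasoning

lift-dominated : ∀ u → Balanced u → Dominated u → Dominated (lift u)
lift-dominated u bal dom = codominated⇒dominated (lift-balanced u bal) codom
  where
  codom : CoDominated (lift u)
  codom zero = ≤-reflexive (lift-balanced u bal)
  codom (suc s) = codominated-++ u (dominated⇒codominated bal dom) codominated-[false] s

lift-strict-suffix : ∀ u → Balanced u → Dominated u →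
  ∀ s → s ≤ length u → ones (drop s (u ++ [ false ])) < zeros (drop s (u ++ [ false ]))
lift-strict-suffix u bal dom = strict-suffix-++ u (dominated⇒codominated bal dom) (s≤s z≤n)

data Shape (x₀ : List Bool) : List Bool → Set where
  lead1  : ∀ {w} → Balanced w → Dominated w → Shape x₀ (true ∷ w)
  trail0 : ∀ {w} → Balanced w → Dominated w → w ≢ x₀ → Shape x₀ (w ++ [ false ])
  lead0  : ∀ {w} → Balanced w → Dominated w → Shape x₀ (false ∷ w)

shape-suffix : ∀ {x₀ R} → Shape x₀ R → ∀ s → ones (drop (suc s) R) ≤ zeros (drop (suc s) R)
shape-suffix (lead1 bal dom) = dominated⇒codominated bal dom
shape-suffix (trail0 {w} bal dom _) s =
  codominated-++ w (dominated⇒codominated bal dom) codominated-[false] (suc s)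
shape-suffix (lead0 bal dom) = dominated⇒codominated bal dom

module FirstRow (u : List Bool) (bal-u : Balanced u) (dom-u : Dominated u) where

  top-row : List Bool
  top-row = true ∷ lift u

  top-row-shape : Shape (lift u) top-row
  top-row-shape = lead1 (lift-balanced u bal-u) (lift-dominated u bal-u dom-u)

  top-row-prefix : ∀ t → zeros (take (suc t) top-row) < ones (take (suc t) top-row)
  top-row-prefix t = s≤s (lift-dominated u bal-u dom-u t)

  -- a suffix of 11u0 of length ≥ 2 that misses at least its first two letters
  -- starts inside u
  suffix-bound : ∀ t e → suc (suc t) + suc (suc e) ≡ length top-row → suc e ≤ length u
  suffix-bound t e h = s≤s⁻¹ (subst (suc (suc e) ≤_) t+e≡ (m≤n+m (suc (suc e)) t))
    where
    t+e≡ : t + suc (suc e) ≡ suc (length u)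
    t+e≡ = trans (suc-injective (suc-injective (trans h (cong (λ l → suc (suc l)) (length-++ u)))))
                 (+-comm (length u) 1)

  -- a prefix of length ≥ 2 of a shaped row of the same width is never a
  -- proper suffix of 11u0: for 1w the prefix has a surplus of 1s; for 0w and
  -- w0 the suffix lies in u0 and has a surplus of 0s, unless it is all of 1u0,
  -- which 0w cannot start with and w0 excludes by w ≠ 1u0
  no-suffix-is-prefix : ∀ {R} → Shape (lift u) R → length R ≡ length top-row →
    ∀ t e → suc (suc t) + suc e ≡ length top-row → take (suc (suc t)) R ≢ drop (suc e) top-row
  no-suffix-is-prefix (lead1 _ dom-w) _ t e _ eq =
    nonpositive≢positive (sym eq) (shape-suffix top-row-shape e) (s≤s (dom-w (suc t)))
  no-suffix-is-prefix (lead0 _ _) _ t zero _ ()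
  no-suffix-is-prefix (lead0 _ dom-w) _ t (suc e) h eq =
    negative≢nonnegative (drop-tail e (u ++ [ false ]) (sym eq))
      (lift-strict-suffix u bal-u dom-u (suc e) (suffix-bound t e h)) (dom-w (suc t))
  no-suffix-is-prefix (trail0 {w} _ _ w≢lift) hR t zero h eq = w≢lift (begin
    w                                    ≡⟨ sym (take-all (suc (suc t)) w (≤-reflexive w≡k)) ⟩
    take (suc (suc t)) w                 ≡⟨ sym (take-++ˡ (suc (suc t)) w (≤-reflexive (sym w≡k))) ⟩
    take (suc (suc t)) (w ++ [ false ])  ≡⟨ eq ⟩
    lift u                               ∎)
    where
    open ≡-Reasoning
    w≡k : length w ≡ suc (suc t)
    w≡k = trans (length-init w (suc (suc t)) 0 (trans hR (sym h))) (+-identityʳ _)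
  no-suffix-is-prefix (trail0 {w} _ dom-w _) hR t (suc e) h eq =
    negative≢nonnegative (trans (sym eq) (take-++ˡ (suc (suc t)) w k≤w))
      (lift-strict-suffix u bal-u dom-u e (≤-trans (n≤1+n e) (suffix-bound t e h)))
      (dom-w (suc (suc t)))
    where
    k≤w : suc (suc t) ≤ length w
    k≤w = subst (suc (suc t) ≤_) (sym (length-init w (suc (suc t)) (suc e) (trans hR (sym h))))
                (m≤m+n (suc (suc t)) (suc e))

shift-take-drop : ∀ {a b} (x : Vec Bool a) (y : Vec Bool b) d → b ∸ d ≤ a →
  (∀ j j' → toℕ j' ≡ toℕ j + d → lookup x j ≡ lookup y j') →
  take (b ∸ d) (toList x) ≡ drop d (toList y)
shift-take-drop x Vec.[] zero _ _ = refl
shift-take-drop x Vec.[] (suc d) _ _ = refl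
shift-take-drop Vec.[] (c' Vec.∷ y) zero () _
shift-take-drop (c Vec.∷ x) (c' Vec.∷ y) zero b≤a H =
  cong₂ _∷_ (H Fin.zero Fin.zero refl)
    (shift-take-drop x y zero (s≤s⁻¹ b≤a) (λ j j' h → H (Fin.suc j) (Fin.suc j') (cong suc h)))
shift-take-drop x (c' Vec.∷ y) (suc d) b≤a H =
  shift-take-drop x y d b≤a (λ j j' h → H j (Fin.suc j') (trans (cong suc h) (sym (+-suc (toℕ j) d))))

rows-overlap : ∀ {m n} (A B : Matrix m n) p {d k} (i i' : Fin m) → OverlapAt A B p (+ d) →
  + toℕ i' ≡ + toℕ i ℤ.+ p → k + d ≡ n → take k (row A i) ≡ drop d (row B i')
rows-overlap {n = n} A B p {d} {k} i i' ov ri k+d≡n = begin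
  take k (row A i)        ≡⟨ cong (λ l → take l (row A i)) (sym n∸d≡k) ⟩
  take (n ∸ d) (row A i)  ≡⟨ shift-take-drop (lookup A i) (lookup B i') d (m∸n≤m n d)
                               (λ j j' h → ov i i' j j' ri (cong +_ h)) ⟩
  drop d (row B i')       ∎
  where
  open ≡-Reasoning
  n∸d≡k : n ∸ d ≡ k
  n∸d≡k = trans (cong (_∸ d) (sym k+d≡n)) (m+n∸n≡m k d)

shift-back : ∀ a b p → b ≡ a ℤ.+ p → a ≡ b ℤ.+ ℤ.- p
shift-back a b p refl = sym (begin
  a ℤ.+ p ℤ.+ ℤ.- p    ≡⟨ ℤP.+-assoc a p (ℤ.- p) ⟩
  a ℤ.+ (p ℤ.+ ℤ.- p)  ≡⟨ cong (λ z → a ℤ.+ z) (ℤP.+-inverseʳ p) ⟩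
  a ℤ.+ + 0            ≡⟨ ℤP.+-identityʳ a ⟩
  a                    ∎)
  where open ≡-Reasoning

flip-overlap : ∀ {m n} (A B : Matrix m n) p q → OverlapAt A B p q → OverlapAt B A (ℤ.- p) (ℤ.- q)
flip-overlap A B p q ov i i' j j' ri cj = sym (ov i' i j' j (unshift p ri) (unshift q cj))
  where
  unshift : ∀ {a b} r → b ≡ a ℤ.+ ℤ.- r → a ≡ b ℤ.+ r
  unshift {a} {b} r h = trans (shift-back a b (ℤ.- r) h) (cong (λ z → b ℤ.+ z) (ℤP.neg-involutive r))

rows-overlap⁻ : ∀ {m n} (A B : Matrix m n) p {e k} (i i' : Fin m) → OverlapAt A B p -[1+ e ] →
  + toℕ i' ≡ + toℕ i ℤ.+ p → k + suc e ≡ n → take k (row B i') ≡ drop (suc e) (row A i)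
rows-overlap⁻ A B p {e} i i' ov ri =
  rows-overlap B A (ℤ.- p) i' i (flip-overlap A B p -[1+ e ] ov)
    (shift-back (+ toℕ i) (+ toℕ i') p ri)

overlap-width : ∀ {d n} → d < n → ∃ λ t → suc t + d ≡ n
overlap-width {d} {n} d<n = n ∸ suc d , trans (sym (+-suc (n ∸ suc d) d)) (m∸n+n≡m d<n)

vec-ext : ∀ {X : Set} {n} {x y : Vec X n} → (∀ i → lookup x i ≡ lookup y i) → x ≡ y
vec-ext {x = x} {y} h = trans (sym (tabulate∘lookup x)) (trans (tabulate-cong h) (tabulate∘lookup y))

overlap-origin⇒≡ : ∀ {m n} {A B : Matrix m n} → OverlapAt A B (+ 0) (+ 0) → A ≡ B
overlap-origin⇒≡ ov = vec-ext (λ i → vec-ext (λ j → ov i i j j (same (toℕ i)) (same (toℕ j))))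
  where
  same : ∀ k → + k ≡ + k ℤ.+ + 0
  same k = cong +_ (sym (+-identityʳ k))

module Rows (m' n : ℕ) (u : List Bool) (bal-u : Balanced u) (dom-u : Dominated u) where
  open FirstRow u bal-u dom-u

  first-row : ∀ A → L (suc m') n u A → row A Fin.zero ≡ top-row
  first-row A LA = proj₁ LA Fin.zero refl

  width : ∀ A → L (suc m') n u A → length top-row ≡ n
  width A LA = trans (cong length (sym (first-row A LA))) (length-toList (lookup A Fin.zero))

  type-shape : ∀ {R} → Type6 n u R ⊎ Type7 n u R ⊎ Type8 n u R → Shape (lift u) R
  type-shape (inj₁ (_ , dw , _ , refl)) =
    lead1 (dyck-balanced dw) (dyck-dominated dw)
  type-shape (inj₂ (inj₁ (_ , dw , w≢lift , refl))) =
    trail0 (dyck-balanced dw) (dyck-dominated dw) w≢lift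
  type-shape (inj₂ (inj₂ (_ , dw , refl))) =
    lead0 (dyck-balanced dw) (dyck-dominated dw)

  inner-or-last : (i : Fin (suc m')) → suc (toℕ i) < suc m' ⊎ suc (toℕ i) ≡ suc m'
  inner-or-last i with suc (toℕ i) <? suc m'
  ... | yes inner = inj₁ inner
  ... | no ¬inner = inj₂ (≤-antisym (toℕ<n i) (≮⇒≥ ¬inner))

  -- every row of a matrix of L is shaped (the first one as 1w with w = 1u0)
  row-shape : ∀ B → L (suc m') n u B → ∀ i → Shape (lift u) (row B i)
  row-shape B (first , _ , inner-type , last-type) i with toℕ i in i≡
  ... | zero = subst (Shape (lift u)) (sym (first i i≡)) top-row-shape
  ... | suc _ with inner-or-last i
  ...   | inj₁ inner = type-shape (inner-type i (subst (1 ≤_) (sym i≡) (s≤s z≤n)) inner)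
  ...   | inj₂ last = type-shape (map₂ inj₁ (last-type i last))

  last-row-head : ∀ B → L (suc m') n u B → take 1 (row B (fromℕ m')) ≡ [ true ]
  last-row-head B (_ , _ , _ , last-type) = head1 (last-type (fromℕ m') (cong suc (toℕ-fromℕ m')))
    where
    head1 : ∀ {R} → Type6 n u R ⊎ Type7 n u R → take 1 R ≡ [ true ]
    head1 (inj₁ (_ , _ , _ , refl)) = refl
    head1 (inj₂ (_ , dw , _ , refl)) with dyck-head dw
    ... | _ , refl = refl

  below : ∀ {r} → r < suc m' → Fin (suc m')
  below r< = fromℕ< r<

  below-offset : ∀ {r} (r< : r < suc m') → + toℕ (below r<) ≡ + toℕ (Fin.zero {m'}) ℤ.+ + r
  below-offset r< = cong +_ (toℕ-fromℕ< r<)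

  module _ (A B : Matrix (suc m') n) (LA : L (suc m') n u A) (LB : L (suc m') n u B) where

    -- a purely vertical shift would copy 11u0 into a later row of B
    no-vertical-shift : ∀ r → suc r < suc m' → ¬ OverlapAt A B (+ suc r) (+ 0)
    no-vertical-shift r r< ov = proj₁ (proj₂ LB) (below r<) later (begin
      row B (below r<)         ≡⟨ sym (rows-overlap A B (+ suc r) Fin.zero (below r<) ov
                                         (below-offset r<) (+-identityʳ n)) ⟩
      take n (row A Fin.zero)  ≡⟨ take-all n _ (≤-reflexive (length-toList (lookup A Fin.zero))) ⟩
      row A Fin.zero           ≡⟨ first-row A LA ⟩
      top-row                 ∎)
      where
      open ≡-Reasoning
      later : 1 ≤ toℕ (below r<)
      later = subst (1 ≤_) (sym (toℕ-fromℕ< r<)) (s≤s z≤n)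

    -- a rightward shift puts a nonempty prefix of 11u0 onto a proper suffix of a row
    no-right-shift : ∀ r d → r < suc m' → suc d < n → ¬ OverlapAt A B (+ r) (+ suc d)
    no-right-shift r d r< d< ov with overlap-width d<
    ... | t , h =
      nonpositive≢positive suffix≡prefix (shape-suffix (row-shape B LB (below r<)) d) (top-row-prefix t)
      where
      suffix≡prefix : drop (suc d) (row B (below r<)) ≡ take (suc t) top-row
      suffix≡prefix = sym (trans (cong (take (suc t)) (sym (first-row A LA)))
                                 (rows-overlap A B (+ r) Fin.zero (below r<) ov (below-offset r<) h))

    -- a leftward shift: for width 1 compare the last rows, otherwise the first row
    no-left-shift : ∀ r e → r < suc m' → suc e < n → ¬ OverlapAt A B (+ r) -[1+ e ]
    no-left-shift r e r< e< ov with overlap-width e<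
    ... | zero , h = nonpositive≢positive (sym last≡) (shape-suffix (row-shape A LA i₂) e) (s≤s z≤n)
      where
      i₂ : Fin (suc m')
      i₂ = fromℕ< (s≤s (m∸n≤m m' r))
      offset : + toℕ (fromℕ m') ≡ + toℕ i₂ ℤ.+ + r
      offset = cong +_ (begin
        toℕ (fromℕ m')  ≡⟨ toℕ-fromℕ m' ⟩
        m'              ≡⟨ sym (m∸n+n≡m (s≤s⁻¹ r<)) ⟩
        m' ∸ r + r      ≡⟨ cong (_+ r) (sym (toℕ-fromℕ< (s≤s (m∸n≤m m' r)))) ⟩
        toℕ i₂ + r      ∎)
        where open ≡-Reasoning
      last≡ : [ true ] ≡ drop (suc e) (row A i₂)
      last≡ = trans (sym (last-row-head B LB)) (rows-overlap⁻ A B (+ r) i₂ (fromℕ m') ov offset h)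
    ... | suc t , h =
      no-suffix-is-prefix (row-shape B LB (below r<)) width-B t e (trans h (sym (width A LA))) prefix≡suffix
      where
      width-B : length (row B (below r<)) ≡ length top-row
      width-B = trans (length-toList (lookup B (below r<))) (sym (width A LA))
      prefix≡suffix : take (suc (suc t)) (row B (below r<)) ≡ drop (suc e) top-row
      prefix≡suffix = trans (rows-overlap⁻ A B (+ r) Fin.zero (below r<) ov (below-offset r<) h)
                            (cong (drop (suc e)) (first-row A LA))

    nonneg-overlap : ∀ r q → AdmShift (suc m') n (+ r) q → OverlapAt A B (+ r) q →
      r ≡ 0 × q ≡ + 0
    nonneg-overlap zero (+ zero) _ _ = refl , refl
    nonneg-overlap (suc r) (+ zero) (r< , _) ov = ⊥-elim (no-vertical-shift r r< ov)
    nonneg-overlap r (+ suc d) (r< , d<) ov = ⊥-elim (no-right-shift r d r< d< ov)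
    nonneg-overlap r -[1+ e ] (r< , e<) ov = ⊥-elim (no-left-shift r e r< e< ov)

  overlap⇒origin : ∀ A B → L (suc m') n u A → L (suc m') n u B →
    ∀ p q → AdmShift (suc m') n p q → OverlapAt A B p q → p ≡ + 0 × q ≡ + 0
  overlap⇒origin A B LA LB (+ r) q adm ov with nonneg-overlap A B LA LB r q adm ov
  ... | refl , refl = refl , refl
  overlap⇒origin A B LA LB -[1+ r ] q (r< , q<) ov
    with nonneg-overlap B A LB LA (suc r) (ℤ.- q) (r< , subst (_< n) (sym (ℤP.∣-i∣≡∣i∣ q)) q<)
           (flip-overlap A B -[1+ r ] q ov)
  ... | () , _

proposition2 : (m n : ℕ) → 2 ≤ m → 5 ≤ n → Odd n →
    (u : List Bool) → Dyck ((n ∸ 3) / 2) u →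
    NonOverlappingSet (L m n u)
proposition2 zero _ () _ _ _ _
proposition2 (suc m') n _ _ _ u du = self , distinct
  where
  open Rows m' n u (dyck-balanced du) (dyck-dominated du)

  self : ∀ A → L (suc m') n u A → SelfNonOverlapping A
  self A LA p q adm nontrivial ov = nontrivial (overlap⇒origin A A LA LA p q adm ov)

  distinct : ∀ A B → L (suc m') n u A → L (suc m') n u B → A ≢ B → NonOverlapping A B
  distinct A B LA LB A≢B p q adm ov with overlap⇒origin A B LA LB p q adm ov
  ... | refl , refl = A≢B (overlap-origin⇒≡ ov)
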